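{- Let $\sigma_{\widehat{\mathrm{mex}}}(n)$ denote the sum of $\widehat{\mathrm{mex}}(\pi)$ over all overpartitions $\pi$ of $n$ (for $n\ge1$), with $\sigma_{\widehat{\mathrm{mex}}}(0)=1$. Then \[\lim_{X\to+\infty}\frac{\#\{n\le X:\ \sigma_{\widehat{\mathrm{mex}}}(n)\equiv 0 \pmod 2\}}{X}=1.\]
   Context: An overpartition of a positive integer $n$ is a non-increasing sequence of positive integers summing to $n$ in which the first occurrence of each number may (or may not) be overlined. For an overpartition $\pi$, $\widehat{\mathrm{mex}}(\pi)$ is the smallest positive integer that does not occur as an overlined part of $\pi$. Here $n$ ranges over nonnegative integers. -}

module Defs where

open import Data.Nat using (ℕ; zero; suc; _+_; _*_; _∸_; _≤ᵇ_; _≡ᵇ_)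
open import Data.Bool using (Bool; true; false; if_then_else_; _∧_)
open import Data.Product using (_×_; _,_; proj₁; proj₂)
open import Data.List using (List; []; _∷_; _++_; map; concatMap; filter; replicate; length; upTo; filterᵇ)
open import Data.Bool.ListAction using (any)
open import Data.Nat.ListAction using (sum)

-- An overpartition is represented as a list of parts in non-increasing
-- order; each entry is (part , overlined?).  Only the first occurrence
-- (the leftmost entry) of a given part size may carry the overline.
Overpartition : Set
Overpartition = List (ℕ × Bool)

-- All overpartitions of n whose parts are all ≤ m (each exactly once).
overpartitionsBounded : ℕ → ℕ → List Overpartition
overpartitionsBounded zero zero = [] ∷ []
overpartitionsBounded zero (suc n) = []
overpartitionsBounded (suc m) n =
  overpartitionsBounded m n ++
  concatMap (λ c →
      concatMap (λ b →
          map (λ rest → ((suc m , b) ∷ replicate c (suc m , false)) ++ rest)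
              (overpartitionsBounded m (n ∸ suc c * suc m)))
        (false ∷ true ∷ []))
    (filterᵇ (λ c → suc c * suc m ≤ᵇ n) (upTo n))

overpartitions : ℕ → List Overpartition
overpartitions n = overpartitionsBounded n n

isOverlinedPart : ℕ → Overpartition → Bool
isOverlinedPart k π = any (λ e → (proj₁ e ≡ᵇ k) ∧ proj₂ e) π

-- mex-hat: least positive integer k that is not an overlined part of π.
-- The search from 1 needs at most length π + 1 steps.
mexHatFrom : ℕ → ℕ → Overpartition → ℕ
mexHatFrom zero k π = k
mexHatFrom (suc fuel) k π =
  if isOverlinedPart k π then mexHatFrom fuel (suc k) π else k

mexHat : Overpartition → ℕ
mexHat π = mexHatFrom (suc (length π)) 1 π

σmex : ℕ → ℕ
σmex zero = 1
σmex n@(suc _) = sum (map mexHat (overpartitions n))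

isEven : ℕ → Bool
isEven zero = true
isEven (suc zero) = false
isEven (suc (suc n)) = isEven n

evenCount : ℕ → ℕ
evenCount X = length (filterᵇ (λ n → isEven (σmex n)) (upTo (suc X)))

{-# OPTIONS --safe #-}
-- Group the overpartitions with parts ≤ m + 1 by the multiplicity c + 1 of the part m + 1: each
-- overpartition ρ with parts ≤ m occurs twice, with that block plain or with its first copy overlined.
-- Both keep the mex-hat of ρ, except that overlining m + 1 raises it by one when ρ overlines all of
-- 1, …, m. So modulo 2, σmex(n) counts the overpartitions of n whose overlined parts are 1, …, m and
-- whose parts are ≤ m, for some m; reading off the multiplicities (add c + 1 to every part, append the
-- part c + 1) matches them with the strict partitions of n. Franklin's involution pairs off these
-- unless n is a pentagonal number m(3m ∓ 1)/2, and there are only O(√X) such numbers up to X.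
module Submission where

open import Defs

module Parity where

  open import Data.Bool using (Bool; true; false; not; T; _∧_; _∨_)
  open import Data.Bool.Properties using (∨-assoc; ∨-zeroʳ; ∧-zeroʳ; ∧-identityʳ; T-∨; T-not-≡)
  open import Data.Empty using (⊥-elim)
  import Data.Integer as ℤ
  open import Data.Integer using (_⊖_)
  open import Data.Integer.Properties using (∣⊖∣-≤; ∣m⊖n∣≡∣n⊖m∣)
  open import Data.List using (List; []; _∷_; _∷ʳ_; _++_; length; map; filter; filterᵇ; concatMap; upTo; replicate)
  open import Data.List.Membership.Propositional using (_∈_; find; lose)
  open import Data.List.Membership.Propositional.Properties
    using (∈-filter⁺; ∈-filter⁻; ∈-concatMap⁺; ∈-concatMap⁻; ∈-map⁺; ∈-map⁻; ∈-upTo⁺; ∈-upTo⁻; ∈-++⁺ˡ; ∈-++⁺ʳ; ∈-++⁻)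
  open import Data.List.Properties
    using (≡-dec; length-++; length-map; length-replicate; length-upTo; map-++; map-∘; map-cong-local; map-injective;
           filter-all; filter-none; ∷-injectiveˡ; ∷ʳ-injective)
  open import Data.List.Relation.Unary.All as All using (All; []; _∷_)
  open import Data.List.Relation.Unary.Any using (here; there)
  open import Data.List.Relation.Unary.Linked as Linked using (Linked; []; [-]; _∷_)
  import Data.List.Relation.Unary.Linked.Properties as Linked
  open import Data.List.Relation.Unary.Unique.Propositional using (Unique; []; _∷_)
  open import Data.List.Relation.Unary.Unique.Propositional.Properties using (filter⁺; Unique[x∷xs]⇒x∉xs; ++⁺; map⁺; upTo⁺)
  open import Data.Nat
  open import Data.Nat.DivMod using (_/_; m/n*n≤m; /-monoˡ-≤; m*n/n≡m)
  open import Data.Nat.Divisibility using (_∣_; divides; _∣0; ∣-refl; ∣m∣n⇒∣m+n; m∣m*n)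
  open import Data.Nat.ListAction using (sum)
  open import Data.Nat.ListAction.Properties using (sum-++)
  open import Data.Nat.Properties
  open import Algebra.Properties.CommutativeSemigroup +-commutativeSemigroup using (interchange; x∙yz≈y∙xz)
  open import Data.Nat.Tactic.RingSolver using (solve-∀)
  open import Data.Product using (∃; _×_; _,_; proj₁; proj₂; map₂)
  open import Data.Sum using (_⊎_; inj₁; inj₂)
  import Data.Sum as Sum
  open import Data.Unit using (tt)
  open import Function using (_∘_)
  open import Function.Bundles using (Equivalence)
  open import Relation.Binary.Definitions using (DecidableEquality)
  open import Relation.Binary.PropositionalEquality
  open import Relation.Nullary using (¬_; Dec; yes; no; ¬?; contradiction)
  open import Relation.Nullary.Decidable using (_×-dec_; _⊎-dec_; T?)

  module _ {A : Set} (_≟ᴬ_ : DecidableEquality A) (ι : A → A) where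

    private
      without : A → List A → List A
      without a = filter (λ y → ¬? (y ≟ᴬ a))

      length-without : ∀ {a ys} → Unique ys → a ∈ ys → length ys ≡ suc (length (without a ys))
      length-without {ys = y ∷ ys} (y∉ys ∷ _) (here refl) with y ≟ᴬ y
      ... | yes _ = cong suc (cong length (sym (filter-all _ (All.map (λ y≢z z≡y → y≢z (sym z≡y)) y∉ys))))
      ... | no y≢y = ⊥-elim (y≢y refl)
      length-without {a} {y ∷ ys} u@(_ ∷ u′) (there a∈ys) with y ≟ᴬ a
      ... | yes refl = ⊥-elim (Unique[x∷xs]⇒x∉xs u a∈ys)
      ... | no _ = cong suc (length-without u′ a∈ys)

    -- The recursion removes the pair x, ι x, so it runs on fuel n ≥ length xs.
    even-length-of-involution : ∀ n xs → length xs ≤ n → Unique xs →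
      (∀ {x} → x ∈ xs → ι x ∈ xs) → (∀ {x} → x ∈ xs → ι (ι x) ≡ x) → (∀ {x} → x ∈ xs → ι x ≢ x) →
      2 ∣ length xs
    even-length-of-involution _ [] _ _ _ _ _ = 2 ∣0
    even-length-of-involution (suc n) (x ∷ ys) (s≤s |ys|≤n) u@(_ ∷ uys) closed involutive fixpoint-free =
      subst (2 ∣_) (cong suc (sym |ys|≡1+|zs|)) (∣m∣n⇒∣m+n ∣-refl even-zs)
      where
      ιx∈ys : ι x ∈ ys
      ιx∈ys with closed (here refl)
      ... | here ιx≡x = ⊥-elim (fixpoint-free (here refl) ιx≡x)
      ... | there ιx∈ys = ιx∈ys

      zs : List A
      zs = without (ι x) ys

      |ys|≡1+|zs| : length ys ≡ suc (length zs)
      |ys|≡1+|zs| = length-without uys ιx∈ys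

      from-zs : ∀ {y} → y ∈ zs → y ∈ ys × y ≢ ι x
      from-zs = ∈-filter⁻ (λ y → ¬? (y ≟ᴬ ι x))

      closed-zs : ∀ {y} → y ∈ zs → ι y ∈ zs
      closed-zs {y} y∈zs with from-zs y∈zs
      ... | y∈ys , y≢ιx with closed (there y∈ys)
      ...   | here ιy≡x = ⊥-elim (y≢ιx (trans (sym (involutive (there y∈ys))) (cong ι ιy≡x)))
      ...   | there ιy∈ys = ∈-filter⁺ (λ y → ¬? (y ≟ᴬ ι x)) ιy∈ys ιy≢ιx
        where
        ιy≢ιx : ι y ≢ ι x
        ιy≢ιx ιy≡ιx = Unique[x∷xs]⇒x∉xs u
          (subst (_∈ ys) (trans (sym (involutive (there y∈ys))) (trans (cong ι ιy≡ιx) (involutive (here refl)))) y∈ys)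

      even-zs : 2 ∣ length zs
      even-zs = even-length-of-involution n zs
        (≤-trans (n≤1+n _) (subst (_≤ n) |ys|≡1+|zs| |ys|≤n))
        (filter⁺ (λ y → ¬? (y ≟ᴬ ι x)) uys) closed-zs
        (λ y∈zs → involutive (there (proj₁ (from-zs y∈zs))))
        (λ y∈zs → fixpoint-free (there (proj₁ (from-zs y∈zs))))

  init : {A : Set} → List A → List A
  init [] = []
  init (x ∷ []) = []
  init (x ∷ y ∷ r) = x ∷ init (y ∷ r)

  init-∷ʳ : {A : Set} (xs : List A) (x : A) → init (xs ∷ʳ x) ≡ xs
  init-∷ʳ [] x = refl
  init-∷ʳ (y ∷ []) x = refl
  init-∷ʳ (y ∷ z ∷ r) x = cong (y ∷_) (init-∷ʳ (z ∷ r) x)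

  length-∷ʳ : {A : Set} (xs : List A) (x : A) → length (xs ∷ʳ x) ≡ suc (length xs)
  length-∷ʳ [] x = refl
  length-∷ʳ (y ∷ r) x = cong suc (length-∷ʳ r x)

  length-init : {A : Set} (x : A) (xs : List A) → length (init (x ∷ xs)) ≡ length xs
  length-init x [] = refl
  length-init x (y ∷ r) = cong suc (length-init y r)

  mapFirst : {A : Set} → ℕ → (A → A) → List A → List A
  mapFirst zero f xs = xs
  mapFirst (suc k) f [] = []
  mapFirst (suc k) f (x ∷ xs) = f x ∷ mapFirst k f xs

  length-mapFirst : {A : Set} (k : ℕ) (f : A → A) (xs : List A) → length (mapFirst k f xs) ≡ length xs
  length-mapFirst zero f xs = refl
  length-mapFirst (suc k) f [] = refl
  length-mapFirst (suc k) f (x ∷ xs) = cong suc (length-mapFirst k f xs)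

  mapFirst-inverse : {A : Set} (k : ℕ) {f g : A → A} {xs : List A} →
    All (λ x → f (g x) ≡ x) xs → mapFirst k f (mapFirst k g xs) ≡ xs
  mapFirst-inverse zero _ = refl
  mapFirst-inverse (suc k) [] = refl
  mapFirst-inverse (suc k) (fgx≡x ∷ rest) = cong₂ _∷_ fgx≡x (mapFirst-inverse k rest)

  pred-suc-inverse : ∀ xs → All (λ x → pred (suc x) ≡ x) xs
  pred-suc-inverse xs = All.tabulate (λ _ → refl)

  suc-pred-inverse : ∀ {xs} → All (0 <_) xs → All (λ x → suc (pred x) ≡ x) xs
  suc-pred-inverse = All.map (λ 0<x → suc-pred _ {{>-nonZero 0<x}})

  Unique-concatMap : {A B : Set} (f : A → List B) {xs : List A} → Unique xs → (∀ x → Unique (f x)) →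
    (∀ {x x′ y} → y ∈ f x → y ∈ f x′ → x ≡ x′) → Unique (concatMap f xs)
  Unique-concatMap f [] _ _ = []
  Unique-concatMap f {x ∷ xs} (x∉xs ∷ u) unique-f disjoint = ++⁺ (unique-f x) (Unique-concatMap f u unique-f disjoint) apart
    where
    apart : ∀ {y} → ¬ (y ∈ f x × y ∈ concatMap f xs)
    apart (y∈fx , y∈rest) with find (∈-concatMap⁻ f {xs = xs} y∈rest)
    ... | x′ , x′∈xs , y∈fx′ = All.lookup x∉xs x′∈xs (disjoint y∈fx y∈fx′)

  module _ {A : Set} where

    length-filterᵇ-complement : ∀ (f : A → Bool) xs → length (filterᵇ f xs) + length (filterᵇ (not ∘ f) xs) ≡ length xs
    length-filterᵇ-complement f [] = refl
    length-filterᵇ-complement f (x ∷ xs) with f x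
    ... | true = cong suc (length-filterᵇ-complement f xs)
    ... | false = trans (+-suc _ _) (cong suc (length-filterᵇ-complement f xs))

    length-filterᵇ-mono : ∀ {f g : A → Bool} xs → (∀ {x} → x ∈ xs → T (f x) → T (g x)) → length (filterᵇ f xs) ≤ length (filterᵇ g xs)
    length-filterᵇ-mono [] _ = z≤n
    length-filterᵇ-mono {f} {g} (x ∷ xs) f⇒g with f x | g x | f⇒g (here refl)
    ... | true | true | _ = s≤s (length-filterᵇ-mono xs (f⇒g ∘ there))
    ... | true | false | f⇒g-x = ⊥-elim (f⇒g-x tt)
    ... | false | true | _ = m≤n⇒m≤1+n (length-filterᵇ-mono xs (f⇒g ∘ there))
    ... | false | false | _ = length-filterᵇ-mono xs (f⇒g ∘ there)

    length-filterᵇ-∨ : ∀ (f g : A → Bool) xs → length (filterᵇ (λ x → f x ∨ g x) xs) ≤ length (filterᵇ f xs) + length (filterᵇ g xs)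
    length-filterᵇ-∨ f g [] = z≤n
    length-filterᵇ-∨ f g (x ∷ xs) with f x | g x
    ... | true | true = s≤s (≤-trans (length-filterᵇ-∨ f g xs) (+-monoʳ-≤ _ (n≤1+n _)))
    ... | true | false = s≤s (length-filterᵇ-∨ f g xs)
    ... | false | true = ≤-trans (s≤s (length-filterᵇ-∨ f g xs)) (≤-reflexive (sym (+-suc _ _)))
    ... | false | false = length-filterᵇ-∨ f g xs

  length-filterᵇ-≡ᵇ : ∀ a {xs} → Unique xs → length (filterᵇ (_≡ᵇ a) xs) ≤ 1
  length-filterᵇ-≡ᵇ a {xs} u =
    at-most-one (filter⁺ (T? ∘ (_≡ᵇ a)) u) (All.tabulate (λ y∈ → ≡ᵇ⇒≡ _ a (proj₂ (∈-filter⁻ (T? ∘ (_≡ᵇ a)) {xs = xs} y∈))))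
    where
    at-most-one : ∀ {ys} → Unique ys → All (_≡ a) ys → length ys ≤ 1
    at-most-one [] _ = z≤n
    at-most-one (_ ∷ []) _ = ≤-refl
    at-most-one ((y≢z ∷ _) ∷ _) (refl ∷ refl ∷ _) = ⊥-elim (y≢z refl)

  ∑ : {A : Set} → List A → (A → ℕ) → ℕ
  ∑ xs f = sum (map f xs)

  syntax ∑ xs (λ x → e) = ∑[ x ∈ xs ] e

  ∑-++ : {A : Set} (xs ys : List A) (f : A → ℕ) → ∑ (xs ++ ys) f ≡ ∑ xs f + ∑ ys f
  ∑-++ xs ys f = trans (cong sum (map-++ f xs ys)) (sum-++ (map f xs) (map f ys))

  ∑-concatMap : {A B : Set} (g : A → List B) (xs : List A) (f : B → ℕ) → ∑ (concatMap g xs) f ≡ ∑[ x ∈ xs ] ∑ (g x) f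
  ∑-concatMap g [] f = refl
  ∑-concatMap g (x ∷ xs) f = trans (∑-++ (g x) (concatMap g xs) f) (cong (∑ (g x) f +_) (∑-concatMap g xs f))

  ∑-map : {A B : Set} (g : A → B) (xs : List A) (f : B → ℕ) → ∑ (map g xs) f ≡ ∑ xs (f ∘ g)
  ∑-map g xs f = cong sum (sym (map-∘ xs))

  ∑-cong : {A : Set} (xs : List A) {f g : A → ℕ} → (∀ {x} → x ∈ xs → f x ≡ g x) → ∑ xs f ≡ ∑ xs g
  ∑-cong xs f≗g = cong sum (map-cong-local (All.tabulate f≗g))

  ∑-+ : {A : Set} (xs : List A) (f g : A → ℕ) → ∑[ x ∈ xs ] (f x + g x) ≡ ∑ xs f + ∑ xs g
  ∑-+ [] f g = refl
  ∑-+ (x ∷ xs) f g = trans (cong (f x + g x +_) (∑-+ xs f g)) (interchange (f x) (g x) (∑ xs f) (∑ xs g))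

  ∑-zero : {A : Set} (xs : List A) → ∑[ x ∈ xs ] 0 ≡ 0
  ∑-zero [] = refl
  ∑-zero (x ∷ xs) = ∑-zero xs

  length-concatMap : {A B : Set} (g : A → List B) (xs : List A) → length (concatMap g xs) ≡ ∑[ x ∈ xs ] length (g x)
  length-concatMap g [] = refl
  length-concatMap g (x ∷ xs) = trans (length-++ (g x)) (cong (length (g x) +_) (length-concatMap g xs))

  -- Strict partitions and Franklin's involution

  smallest : List ℕ → ℕ
  smallest [] = 0
  smallest (x ∷ []) = x
  smallest (x ∷ y ∷ r) = smallest (y ∷ r)

  smallest-∷ʳ : ∀ xs x → smallest (xs ∷ʳ x) ≡ x
  smallest-∷ʳ [] x = refl
  smallest-∷ʳ (y ∷ []) x = refl
  smallest-∷ʳ (y ∷ z ∷ r) x = smallest-∷ʳ (z ∷ r) x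

  init-∷ʳ-smallest : ∀ x xs → init (x ∷ xs) ∷ʳ smallest (x ∷ xs) ≡ x ∷ xs
  init-∷ʳ-smallest x [] = refl
  init-∷ʳ-smallest x (y ∷ r) = cong (x ∷_) (init-∷ʳ-smallest y r)

  sum-∷ʳ : ∀ xs x → sum (xs ∷ʳ x) ≡ sum xs + x
  sum-∷ʳ xs x = trans (sum-++ xs (x ∷ [])) (cong (sum xs +_) (+-identityʳ x))

  sum-init : ∀ x xs → sum (init (x ∷ xs)) + smallest (x ∷ xs) ≡ sum (x ∷ xs)
  sum-init x xs = trans (sym (sum-∷ʳ (init (x ∷ xs)) (smallest (x ∷ xs)))) (cong sum (init-∷ʳ-smallest x xs))

  data Strict : List ℕ → Set where
    [] : Strict []
    [_] : ∀ {x} → 0 < x → Strict (x ∷ [])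
    _∷_ : ∀ {x y r} → y < x → Strict (y ∷ r) → Strict (x ∷ y ∷ r)

  Strict⇒Linked : ∀ {l} → Strict l → Linked _>_ l
  Strict⇒Linked [] = []
  Strict⇒Linked [ _ ] = [-]
  Strict⇒Linked (y<x ∷ s) = y<x ∷ Strict⇒Linked s

  Strict⇒positive : ∀ {l} → Strict l → All (0 <_) l
  Strict⇒positive [] = []
  Strict⇒positive [ 0<x ] = 0<x ∷ []
  Strict⇒positive (y<x ∷ s) with Strict⇒positive s
  ... | 0<y ∷ ps = <-trans 0<y y<x ∷ 0<y ∷ ps

  smallest-positive : ∀ {x xs} → Strict (x ∷ xs) → 0 < smallest (x ∷ xs)
  smallest-positive [ 0<x ] = 0<x
  smallest-positive (_ ∷ s) = smallest-positive s

  smallest<init : ∀ {x xs} → Strict (x ∷ xs) → All (smallest (x ∷ xs) <_) (init (x ∷ xs))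
  smallest<init [ _ ] = []
  smallest<init (y<x ∷ [ _ ]) = y<x ∷ []
  smallest<init (y<x ∷ s@(_ ∷ _)) with smallest<init s
  ... | s<y ∷ rest = <-trans s<y y<x ∷ s<y ∷ rest

  Strict-init : ∀ {l} → Strict l → Strict (init l)
  Strict-init [] = []
  Strict-init [ _ ] = []
  Strict-init (y<x ∷ [ 0<y ]) = [ <-trans 0<y y<x ]
  Strict-init (y<x ∷ s@(_ ∷ _)) = y<x ∷ Strict-init s

  Strict-∷ʳ : ∀ {xs t} → Linked _>_ xs → t < smallest xs → 0 < t → Strict (xs ∷ʳ t)
  Strict-∷ʳ [-] t<x 0<t = t<x ∷ [ 0<t ]
  Strict-∷ʳ (y<x ∷ d) t<s 0<t = y<x ∷ Strict-∷ʳ d t<s 0<t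

  sum-mapFirst-suc : ∀ k xs → k ≤ length xs → sum (mapFirst k suc xs) ≡ k + sum xs
  sum-mapFirst-suc zero xs _ = refl
  sum-mapFirst-suc (suc k) (x ∷ xs) (s≤s k≤n) = begin
    suc x + sum (mapFirst k suc xs) ≡⟨ cong (suc x +_) (sum-mapFirst-suc k xs k≤n) ⟩
    suc x + (k + sum xs)            ≡⟨ cong suc (x∙yz≈y∙xz x k (sum xs)) ⟩
    suc k + (x + sum xs)            ∎
    where open ≡-Reasoning

  sum-mapFirst-pred : ∀ k xs → All (0 <_) xs → k ≤ length xs → sum (mapFirst k pred xs) + k ≡ sum xs
  sum-mapFirst-pred k xs pos k≤n = begin
    sum (mapFirst k pred xs) + k                       ≡⟨ +-comm _ k ⟩
    k + sum (mapFirst k pred xs)                       ≡⟨ sum-mapFirst-suc k _ (subst (k ≤_) (sym (length-mapFirst k pred xs)) k≤n) ⟨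
    sum (mapFirst k suc (mapFirst k pred xs))          ≡⟨ cong sum (mapFirst-inverse k (suc-pred-inverse pos)) ⟩
    sum xs                                             ∎
    where open ≡-Reasoning

  continueRun : {P : Set} → Dec P → ℕ → ℕ
  continueRun (yes _) k = suc k
  continueRun (no _) _ = 1

  slope : List ℕ → ℕ
  slope [] = 0
  slope (x ∷ []) = 1
  slope (x ∷ y ∷ r) = continueRun (x ≟ suc y) (slope (y ∷ r))

  slope-positive : ∀ x xs → 0 < slope (x ∷ xs)
  slope-positive x [] = ≤-refl
  slope-positive x (y ∷ r) with x ≟ suc y
  ... | yes _ = z<s
  ... | no _ = z<s

  slope≤length : ∀ l → slope l ≤ length l
  slope≤length [] = z≤n
  slope≤length (x ∷ []) = ≤-refl
  slope≤length (x ∷ y ∷ r) = continueRun-≤ (x ≟ suc y) (slope≤length (y ∷ r))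
    where
    continueRun-≤ : ∀ {P : Set} {k n} (d : Dec P) → k ≤ n → continueRun d k ≤ suc n
    continueRun-≤ (yes _) k≤n = s≤s k≤n
    continueRun-≤ (no _) _ = s≤s z≤n

  slope-++ : ∀ xs ys → slope xs ≤ slope (xs ++ ys)
  slope-++ [] ys = z≤n
  slope-++ (x ∷ []) [] = ≤-refl
  slope-++ (x ∷ []) (y ∷ ys) = slope-positive x (y ∷ ys)
  slope-++ (x ∷ y ∷ r) ys = continueRun-mono (x ≟ suc y) (slope-++ (y ∷ r) ys)
    where
    continueRun-mono : ∀ {P : Set} {k n} (d : Dec P) → k ≤ n → continueRun d k ≤ continueRun d n
    continueRun-mono (yes _) k≤n = s≤s k≤n
    continueRun-mono (no _) _ = ≤-refl

  slope-init : ∀ {k} l → k ≤ slope l → k ≤ length (init l) → k ≤ slope (init l)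
  slope-init [] _ k≤len = k≤len
  slope-init (x ∷ []) _ k≤len = k≤len
  slope-init (x ∷ y ∷ []) _ k≤len = k≤len
  slope-init {zero} (x ∷ y ∷ z ∷ r) _ _ = z≤n
  slope-init {suc k} (x ∷ y ∷ z ∷ r) k≤slope k≤len with x ≟ suc y
  ... | no _ = k≤slope
  ... | yes _ = s≤s (slope-init (y ∷ z ∷ r) (≤-pred k≤slope) (≤-pred k≤len))

  slope-mapFirst-suc : ∀ k {xs} → Strict xs → 0 < k → k ≤ slope xs → k ≤ length xs → slope (mapFirst k suc xs) ≡ k
  slope-mapFirst-suc (suc zero) [ _ ] _ _ _ = refl
  slope-mapFirst-suc (suc (suc k)) [ _ ] _ (s≤s ()) _
  slope-mapFirst-suc (suc zero) {x ∷ y ∷ r} (y<x ∷ _) _ _ _ with suc x ≟ suc y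
  ... | yes x+1≡y+1 = ⊥-elim (<-irrefl (sym (suc-injective x+1≡y+1)) y<x)
  ... | no _ = refl
  slope-mapFirst-suc (suc (suc k)) {x ∷ y ∷ r} (_ ∷ s) _ k≤slope k≤len with x ≟ suc y
  ... | no _ = ⊥-elim (n≮0 (≤-pred k≤slope))
  ... | yes refl with suc (suc y) ≟ suc (suc y)
  ...   | yes _ = cong suc (slope-mapFirst-suc (suc k) s z<s (≤-pred k≤slope) (≤-pred k≤len))
  ...   | no y+2≢y+2 = ⊥-elim (y+2≢y+2 refl)

  slope-mapFirst-pred : ∀ k {xs} → Strict xs → 0 < k → k ≤ slope xs → k ≤ slope (mapFirst k pred xs)
  slope-mapFirst-pred (suc zero) {x ∷ xs} _ _ _ = slope-positive (pred x) xs
  slope-mapFirst-pred (suc (suc k)) [ _ ] _ (s≤s ())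
  slope-mapFirst-pred (suc (suc k)) {x ∷ y ∷ r} (_ ∷ s) _ k≤slope with x ≟ suc y
  ... | no _ = ⊥-elim (n≮0 (≤-pred k≤slope))
  ... | yes refl with y ≟ suc (pred y)
  ...   | yes _ = s≤s (slope-mapFirst-pred (suc k) s z<s (≤-pred k≤slope))
  ...   | no y≢y = ⊥-elim (y≢y (sym (suc-pred y {{>-nonZero (All.head (Strict⇒positive s))}})))

  smallest≤smallest-mapFirst-suc : ∀ k ys → smallest ys ≤ smallest (mapFirst k suc ys)
  smallest≤smallest-mapFirst-suc zero ys = ≤-refl
  smallest≤smallest-mapFirst-suc (suc k) [] = ≤-refl
  smallest≤smallest-mapFirst-suc (suc zero) (y ∷ []) = n≤1+n y
  smallest≤smallest-mapFirst-suc (suc (suc k)) (y ∷ []) = n≤1+n y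
  smallest≤smallest-mapFirst-suc (suc zero) (y ∷ z ∷ r) = ≤-refl
  smallest≤smallest-mapFirst-suc (suc (suc k)) (y ∷ z ∷ r) = smallest≤smallest-mapFirst-suc (suc k) (z ∷ r)

  smallest-mapFirst-< : ∀ {f} k l → k < length l → smallest (mapFirst k f l) ≡ smallest l
  smallest-mapFirst-< zero l _ = refl
  smallest-mapFirst-< (suc zero) (x ∷ []) (s≤s ())
  smallest-mapFirst-< (suc zero) (x ∷ y ∷ r) _ = refl
  smallest-mapFirst-< (suc (suc k)) (x ∷ y ∷ r) (s≤s k<len) = smallest-mapFirst-< (suc k) (y ∷ r) k<len

  smallest-mapFirst-length : ∀ {f} x xs → smallest (mapFirst (length (x ∷ xs)) f (x ∷ xs)) ≡ f (smallest (x ∷ xs))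
  smallest-mapFirst-length x [] = refl
  smallest-mapFirst-length x (y ∷ r) = smallest-mapFirst-length y r

  smallest<smallest-init : ∀ {x y r} → Strict (x ∷ y ∷ r) → smallest (x ∷ y ∷ r) < smallest (init (x ∷ y ∷ r))
  smallest<smallest-init (y<x ∷ [ _ ]) = y<x
  smallest<smallest-init (_ ∷ s@(_ ∷ _)) = smallest<smallest-init s

  Linked-mapFirst-pred-slope : ∀ {l} → Strict l → Linked _>_ (mapFirst (slope l) pred l)
  Linked-mapFirst-pred-slope [] = []
  Linked-mapFirst-pred-slope [ _ ] = [-]
  Linked-mapFirst-pred-slope {x ∷ y ∷ r} (y<x ∷ s) with x ≟ suc y
  ... | yes refl = prepend (slope (y ∷ r)) (slope-positive y r) (Linked-mapFirst-pred-slope s)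
    where
    prepend : ∀ k → 0 < k → Linked _>_ (mapFirst k pred (y ∷ r)) → Linked _>_ (y ∷ mapFirst k pred (y ∷ r))
    prepend (suc k) _ rest = m≤pred[n]⇒suc[m]≤n {{>-nonZero (All.head (Strict⇒positive s))}} ≤-refl ∷ rest
  ... | no x≢y+1 = y<x-1 ∷ Strict⇒Linked s
    where
    y<x-1 : y < pred x
    y<x-1 = ≤∧≢⇒< (<⇒≤pred y<x)
      (λ y≡x-1 → x≢y+1 (trans (sym (suc-pred x {{>-nonZero (<-≤-trans z<s y<x)}})) (cong suc (sym y≡x-1))))

  Strict-mapFirst-suc : ∀ k {l} → Strict l → Strict (mapFirst k suc l)
  Strict-mapFirst-suc zero s = s
  Strict-mapFirst-suc (suc k) [] = []
  Strict-mapFirst-suc (suc zero) [ _ ] = [ z<s ]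
  Strict-mapFirst-suc (suc (suc k)) [ _ ] = [ z<s ]
  Strict-mapFirst-suc (suc zero) (y<x ∷ s) = m<n⇒m<1+n y<x ∷ s
  Strict-mapFirst-suc (suc (suc k)) (y<x ∷ s) = s≤s y<x ∷ Strict-mapFirst-suc (suc k) s

  Exceptional : List ℕ → Set
  Exceptional l = slope l ≡ length l × (smallest l ≡ length l ⊎ smallest l ≡ suc (length l))

  exceptional? : ∀ l → Dec (Exceptional l)
  exceptional? l = (slope l ≟ length l) ×-dec ((smallest l ≟ length l) ⊎-dec (smallest l ≟ suc (length l)))

  smallestToSlope : List ℕ → List ℕ
  smallestToSlope l = mapFirst (smallest l) suc (init l)

  slopeToSmallest : List ℕ → List ℕ
  slopeToSmallest l = mapFirst (slope l) pred l ∷ʳ slope l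

  franklin : List ℕ → List ℕ
  franklin l with exceptional? l
  ... | yes _ = l
  ... | no _ with smallest l ≤? slope l
  ...   | yes _ = smallestToSlope l
  ...   | no _ = slopeToSmallest l

  franklin-≤ : ∀ l → ¬ Exceptional l → smallest l ≤ slope l → franklin l ≡ smallestToSlope l
  franklin-≤ l regular s≤t with exceptional? l
  ... | yes exc = ⊥-elim (regular exc)
  ... | no _ with smallest l ≤? slope l
  ...   | yes _ = refl
  ...   | no s≰t = ⊥-elim (s≰t s≤t)

  franklin-> : ∀ l → ¬ Exceptional l → slope l < smallest l → franklin l ≡ slopeToSmallest l
  franklin-> l regular t<s with exceptional? l
  ... | yes exc = ⊥-elim (regular exc)
  ... | no _ with smallest l ≤? slope l
  ...   | yes s≤t = ⊥-elim (<⇒≱ t<s s≤t)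
  ...   | no _ = refl

  far-from-length : ∀ {a n} → 2 + n ≤ a → ¬ (a ≡ n ⊎ a ≡ suc n)
  far-from-length 2+n≤a (inj₁ refl) = 1+n≰n (≤-trans (n≤1+n _) 2+n≤a)
  far-from-length 2+n≤a (inj₂ refl) = 1+n≰n 2+n≤a

  below-length : ∀ {a n} → a < n → ¬ (a ≡ n ⊎ a ≡ suc n)
  below-length a<n (inj₁ refl) = <-irrefl refl a<n
  below-length a<n (inj₂ refl) = <-irrefl refl (<-trans a<n (n<1+n _))

  record FranklinPartner (l : List ℕ) : Set where
    field
      strict : Strict (franklin l)
      sum-preserved : sum (franklin l) ≡ sum l
      involutive : franklin (franklin l) ≡ l
      length-changed : length (franklin l) ≢ length l

  module SmallestToSlope {x y : ℕ} {r : List ℕ} (strict : Strict (x ∷ y ∷ r)) (regular : ¬ Exceptional (x ∷ y ∷ r))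
                         (s≤t : smallest (x ∷ y ∷ r) ≤ slope (x ∷ y ∷ r)) where
    private
      l : List ℕ
      l = x ∷ y ∷ r
      s : ℕ
      s = smallest l
      μ : List ℕ
      μ = smallestToSlope l

    s<|l| : s < length l
    s<|l| with m≤n⇒m<n∨m≡n (≤-trans s≤t (slope≤length l))
    ... | inj₁ s<|l| = s<|l|
    ... | inj₂ s≡|l| = ⊥-elim (regular (≤-antisym (slope≤length l) (subst (_≤ slope l) s≡|l| s≤t) , inj₁ s≡|l|))

    |init| : length (init l) ≡ suc (length r)
    |init| = length-init x (y ∷ r)

    s≤|init| : s ≤ length (init l)
    s≤|init| = subst (s ≤_) (sym |init|) (≤-pred s<|l|)

    strict-μ : Strict μ
    strict-μ = Strict-mapFirst-suc s (Strict-init strict)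

    sum-μ : sum μ ≡ sum l
    sum-μ = begin
      sum μ                 ≡⟨ sum-mapFirst-suc s (init l) s≤|init| ⟩
      s + sum (init l)      ≡⟨ +-comm s _ ⟩
      sum (init l) + s      ≡⟨ sum-init x (y ∷ r) ⟩
      sum l                 ∎
      where open ≡-Reasoning

    |μ| : length μ ≡ suc (length r)
    |μ| = trans (length-mapFirst s suc (init l)) |init|

    slope-μ : slope μ ≡ s
    slope-μ = slope-mapFirst-suc s (Strict-init strict) (smallest-positive strict) (slope-init l s≤t s≤|init|) s≤|init|

    s<smallest-μ : s < smallest μ
    s<smallest-μ = ≤-trans (smallest<smallest-init strict) (smallest≤smallest-mapFirst-suc s (init l))

    -- If μ were exceptional, its slope s would be its length, so every part of init l was raised by one.
    regular-μ : ¬ Exceptional μ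
    regular-μ (slope≡|μ| , smallest∈) = far-from-length |μ|+2≤smallest smallest∈
      where
      s≡|μ| : s ≡ length μ
      s≡|μ| = trans (sym slope-μ) slope≡|μ|
      raised : smallest μ ≡ suc (smallest (init l))
      raised = trans (cong (λ k → smallest (mapFirst k suc (init l))) (trans s≡|μ| (length-mapFirst s suc (init l))))
                     (smallest-mapFirst-length x (init (y ∷ r)))
      |μ|+2≤smallest : 2 + length μ ≤ smallest μ
      |μ|+2≤smallest = subst₂ (λ a b → 2 + a ≤ b) s≡|μ| (sym raised) (s≤s (smallest<smallest-init strict))

    slopeToSmallest-μ : slopeToSmallest μ ≡ l
    slopeToSmallest-μ = begin
      mapFirst (slope μ) pred μ ∷ʳ slope μ               ≡⟨ cong (λ k → mapFirst k pred μ ∷ʳ k) slope-μ ⟩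
      mapFirst s pred (mapFirst s suc (init l)) ∷ʳ s      ≡⟨ cong (_∷ʳ s) (mapFirst-inverse s (pred-suc-inverse (init l))) ⟩
      init l ∷ʳ s                                         ≡⟨ init-∷ʳ-smallest x (y ∷ r) ⟩
      l                                                   ∎
      where open ≡-Reasoning

    partner : FranklinPartner l
    partner = record
      { strict = subst Strict (sym μ≡) strict-μ
      ; sum-preserved = trans (cong sum μ≡) sum-μ
      ; involutive = trans (cong franklin μ≡)
          (trans (franklin-> μ regular-μ (subst (_< smallest μ) (sym slope-μ) s<smallest-μ)) slopeToSmallest-μ)
      ; length-changed = length-changed
      }
      where
      μ≡ : franklin l ≡ μ
      μ≡ = franklin-≤ l regular s≤t
      length-changed : length (franklin l) ≢ length l
      length-changed e = 1+n≢n (trans (sym e) (trans (cong length μ≡) |μ|))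

  module SlopeToSmallest {x : ℕ} {xs : List ℕ} (strict : Strict (x ∷ xs)) (regular : ¬ Exceptional (x ∷ xs))
                         (t<s : slope (x ∷ xs) < smallest (x ∷ xs)) where
    private
      l : List ℕ
      l = x ∷ xs
      t : ℕ
      t = slope l
      d : List ℕ
      d = mapFirst t pred l
      ν : List ℕ
      ν = slopeToSmallest l

    0<t : 0 < t
    0<t = slope-positive x xs

    t≤|l| : t ≤ length l
    t≤|l| = slope≤length l

    -- When the slope is all of l, the smallest part drops by one; it stays above t since l is not exceptional.
    t<smallest-d : t < smallest d
    t<smallest-d with m≤n⇒m<n∨m≡n t≤|l|
    ... | inj₁ t<|l| = subst (t <_) (sym (smallest-mapFirst-< t l t<|l|)) t<s
    ... | inj₂ t≡|l| = subst (t <_) (sym lowered) t<s-1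
      where
      lowered : smallest d ≡ pred (smallest l)
      lowered = trans (cong (λ k → smallest (mapFirst k pred l)) t≡|l|) (smallest-mapFirst-length x xs)
      t<s-1 : t < pred (smallest l)
      t<s-1 = <⇒≤pred (≤∧≢⇒< t<s (λ 1+t≡s → regular (t≡|l| , inj₂ (trans (sym 1+t≡s) (cong suc t≡|l|)))))

    strict-ν : Strict ν
    strict-ν = Strict-∷ʳ (Linked-mapFirst-pred-slope strict) t<smallest-d 0<t

    sum-ν : sum ν ≡ sum l
    sum-ν = trans (sum-∷ʳ d t) (sum-mapFirst-pred t l (Strict⇒positive strict) t≤|l|)

    |ν| : length ν ≡ suc (length l)
    |ν| = trans (length-∷ʳ d t) (cong suc (length-mapFirst t pred l))

    smallest-ν : smallest ν ≡ t
    smallest-ν = smallest-∷ʳ d t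

    t≤slope-ν : t ≤ slope ν
    t≤slope-ν = ≤-trans (slope-mapFirst-pred t strict 0<t ≤-refl) (slope-++ d (t ∷ []))

    regular-ν : ¬ Exceptional ν
    regular-ν (_ , smallest∈) = below-length (subst₂ _<_ (sym smallest-ν) (sym |ν|) (s≤s t≤|l|)) smallest∈

    smallestToSlope-ν : smallestToSlope ν ≡ l
    smallestToSlope-ν = begin
      mapFirst (smallest ν) suc (init (d ∷ʳ t))   ≡⟨ cong₂ (λ k ys → mapFirst k suc ys) smallest-ν (init-∷ʳ d t) ⟩
      mapFirst t suc d                            ≡⟨ mapFirst-inverse t (suc-pred-inverse (Strict⇒positive strict)) ⟩
      l                                           ∎
      where open ≡-Reasoning

    partner : FranklinPartner l
    partner = record
      { strict = subst Strict (sym ν≡) strict-ν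
      ; sum-preserved = trans (cong sum ν≡) sum-ν
      ; involutive = trans (cong franklin ν≡)
          (trans (franklin-≤ ν regular-ν (subst (_≤ slope ν) (sym smallest-ν) t≤slope-ν)) smallestToSlope-ν)
      ; length-changed = length-changed
      }
      where
      ν≡ : franklin l ≡ ν
      ν≡ = franklin-> l regular t<s
      length-changed : length (franklin l) ≢ length l
      length-changed e = 1+n≢n (trans (sym |ν|) (trans (sym (cong length ν≡)) e))

  franklin-partner : ∀ {l} → Strict l → ¬ Exceptional l → FranklinPartner l
  franklin-partner {[]} _ regular = ⊥-elim (regular (refl , inj₁ refl))
  franklin-partner {x ∷ xs} strict regular with smallest (x ∷ xs) ≤? slope (x ∷ xs)
  ... | no s≰t = SlopeToSmallest.partner strict regular (≰⇒> s≰t)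
  franklin-partner {x ∷ []} [ 0<x ] regular | yes s≤t = ⊥-elim (regular (refl , inj₁ (≤-antisym s≤t 0<x)))
  franklin-partner {x ∷ y ∷ r} strict regular | yes s≤t = SmallestToSlope.partner strict regular s≤t

  run : ℕ → ℕ → List ℕ
  run s zero = []
  run s (suc k) = k + s ∷ run s k

  full-slope⇒run : ∀ {l} → Strict l → slope l ≡ length l → l ≡ run (smallest l) (length l)
  full-slope⇒run [] _ = refl
  full-slope⇒run [ _ ] _ = refl
  full-slope⇒run {x ∷ y ∷ r} (_ ∷ s) t≡|l| with x ≟ suc y
  ... | yes refl = cong₂ _∷_ (cong suc (∷-injectiveˡ ih)) ih
    where
    ih : y ∷ r ≡ run (smallest (y ∷ r)) (length (y ∷ r))
    ih = full-slope⇒run s (suc-injective t≡|l|)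
  ... | no _ = ⊥-elim (0≢1+n (suc-injective t≡|l|))

  -- m(3m - 1)/2 and m(3m + 1)/2, the sums of the exceptional strict partitions.
  pentagonal⁻ : ℕ → ℕ
  pentagonal⁻ m = sum (run m m)

  pentagonal⁺ : ℕ → ℕ
  pentagonal⁺ m = sum (run (suc m) m)

  IsPentagonal : ℕ → Set
  IsPentagonal n = ∃ λ m → n ≡ pentagonal⁻ m ⊎ n ≡ pentagonal⁺ m

  exceptional⇒pentagonal : ∀ {l} → Strict l → Exceptional l → IsPentagonal (sum l)
  exceptional⇒pentagonal {l} strict (t≡|l| , smallest∈) = length l , Sum.map sum-run sum-run smallest∈
    where
    sum-run : ∀ {s} → smallest l ≡ s → sum l ≡ sum (run s (length l))
    sum-run refl = cong sum (full-slope⇒run strict t≡|l|)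

  -- Enumerating strict partitions by their smallest part

  -- The same range of c as in overpartitionsBounded (suc m) n, so that the two recursions match.
  blockCounts : ℕ → ℕ → List ℕ
  blockCounts m n = filterᵇ (λ c → suc c * suc m ≤ᵇ n) (upTo n)

  ∈-blockCounts⁻ : ∀ {m n c} → c ∈ blockCounts m n → suc c * suc m ≤ n
  ∈-blockCounts⁻ {m} {n} c∈ = ≤ᵇ⇒≤ _ _ (proj₂ (∈-filter⁻ (λ c → T? (suc c * suc m ≤ᵇ n)) {xs = upTo n} c∈))

  ∈-blockCounts⁺ : ∀ {m n c} → suc c * suc m ≤ n → c ∈ blockCounts m n
  ∈-blockCounts⁺ {m} {n} {c} le = ∈-filter⁺ (λ c → T? (suc c * suc m ≤ᵇ n)) (∈-upTo⁺ (≤-trans (m≤m*n (suc c) (suc m)) le)) (≤⇒≤ᵇ le)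

  extend : ℕ → List ℕ → List ℕ
  extend c r = map (suc c +_) r ∷ʳ suc c

  -- The strict partitions of n into exactly m parts, listed by their smallest part c + 1.
  strictPartitions : ℕ → ℕ → List (List ℕ)
  strictPartitions zero zero = [] ∷ []
  strictPartitions zero (suc n) = []
  strictPartitions (suc m) n = concatMap (λ c → map (extend c) (strictPartitions m (n ∸ suc c * suc m))) (blockCounts m n)

  smallest-map : ∀ (f : ℕ → ℕ) x xs → smallest (map f (x ∷ xs)) ≡ f (smallest (x ∷ xs))
  smallest-map f x [] = refl
  smallest-map f x (y ∷ r) = smallest-map f y r

  sum-map-+ : ∀ a r → sum (map (a +_) r) ≡ length r * a + sum r
  sum-map-+ a [] = refl
  sum-map-+ a (x ∷ r) = begin
    a + x + sum (map (a +_) r)        ≡⟨ cong (a + x +_) (sum-map-+ a r) ⟩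
    a + x + (length r * a + sum r)    ≡⟨ interchange a x (length r * a) (sum r) ⟩
    a + length r * a + (x + sum r)    ∎
    where open ≡-Reasoning

  Strict-extend : ∀ c {r} → Strict r → Strict (extend c r)
  Strict-extend c [] = [ z<s ]
  Strict-extend c {x ∷ xs} strict = Strict-∷ʳ (Linked.map⁺ (Linked.map (+-monoʳ-< (suc c)) (Strict⇒Linked strict))) c+1<smallest z<s
    where
    c+1<smallest : suc c < smallest (map (suc c +_) (x ∷ xs))
    c+1<smallest = subst (suc c <_) (sym (smallest-map (suc c +_) x xs)) (m<m+n (suc c) (smallest-positive strict))

  Strict-map-∸ : ∀ a {xs} → Linked _>_ xs → All (a <_) xs → Strict (map (_∸ a) xs)
  Strict-map-∸ a [] [] = []
  Strict-map-∸ a [-] (a<x ∷ []) = [ m<n⇒0<n∸m a<x ]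
  Strict-map-∸ a (y<x ∷ d) (a<x ∷ a<y ∷ rest) = ∸-monoˡ-< y<x (<⇒≤ a<y) ∷ Strict-map-∸ a d (a<y ∷ rest)

  extend-injective : ∀ c {r r′} → extend c r ≡ extend c r′ → r ≡ r′
  extend-injective c {r} {r′} e = map-injective (+-cancelˡ-≡ (suc c) _ _) (proj₁ (∷ʳ-injective (map (suc c +_) r) (map (suc c +_) r′) e))

  sum-extend : ∀ c r → sum (extend c r) ≡ suc c * suc (length r) + sum r
  sum-extend c r = begin
    sum (map (suc c +_) r ∷ʳ suc c)          ≡⟨ sum-∷ʳ (map (suc c +_) r) (suc c) ⟩
    sum (map (suc c +_) r) + suc c           ≡⟨ cong (_+ suc c) (sum-map-+ (suc c) r) ⟩
    length r * suc c + sum r + suc c         ≡⟨ rearrange (suc c) (length r) (sum r) ⟩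
    suc c * suc (length r) + sum r           ∎
    where
    open ≡-Reasoning
    rearrange : ∀ a m s → m * a + s + a ≡ a * suc m + s
    rearrange = solve-∀

  ∈-strictPartitions⁻ : ∀ m n {l} → l ∈ strictPartitions m n → Strict l × length l ≡ m × sum l ≡ n
  ∈-strictPartitions⁻ zero zero (here refl) = [] , refl , refl
  ∈-strictPartitions⁻ (suc m) n l∈
    with find (∈-concatMap⁻ (λ c → map (extend c) (strictPartitions m (n ∸ suc c * suc m))) {xs = blockCounts m n} l∈)
  ... | c , c∈ , l∈′ with ∈-map⁻ (extend c) l∈′
  ...   | r , r∈ , refl with ∈-strictPartitions⁻ m (n ∸ suc c * suc m) r∈
  ...     | strict , refl , sum-r =
    Strict-extend c strict ,
    trans (length-∷ʳ (map (suc c +_) r) (suc c)) (cong suc (length-map (suc c +_) r)) ,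
    trans (sum-extend c r) (trans (cong (suc c * suc (length r) +_) sum-r) (m+[n∸m]≡n (∈-blockCounts⁻ c∈)))

  shrink : ℕ → List ℕ → List ℕ
  shrink c l = map (_∸ suc c) (init l)

  module _ {x xs c} (strict : Strict (x ∷ xs)) (smallest≡1+c : smallest (x ∷ xs) ≡ suc c) where
    private
      a<init : All (suc c <_) (init (x ∷ xs))
      a<init = subst (λ b → All (b <_) (init (x ∷ xs))) smallest≡1+c (smallest<init strict)

    extend-shrink : extend c (shrink c (x ∷ xs)) ≡ x ∷ xs
    extend-shrink = begin
      map (suc c +_) (map (_∸ suc c) (init (x ∷ xs))) ∷ʳ suc c   ≡⟨ cong (_∷ʳ suc c) (map-+∸ (All.map <⇒≤ a<init)) ⟩
      init (x ∷ xs) ∷ʳ suc c                                     ≡⟨ cong (init (x ∷ xs) ∷ʳ_) smallest≡1+c ⟨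
      init (x ∷ xs) ∷ʳ smallest (x ∷ xs)                         ≡⟨ init-∷ʳ-smallest x xs ⟩
      x ∷ xs                                                     ∎
      where
      open ≡-Reasoning
      map-+∸ : ∀ {ys} → All (suc c ≤_) ys → map (suc c +_) (map (_∸ suc c) ys) ≡ ys
      map-+∸ [] = refl
      map-+∸ (a≤y ∷ rest) = cong₂ _∷_ (m+[n∸m]≡n a≤y) (map-+∸ rest)

    Strict-shrink : Strict (shrink c (x ∷ xs))
    Strict-shrink = Strict-map-∸ (suc c) (Strict⇒Linked (Strict-init strict)) a<init

    length-shrink : length (shrink c (x ∷ xs)) ≡ length xs
    length-shrink = trans (length-map (_∸ suc c) (init (x ∷ xs))) (length-init x xs)

  ∈-strictPartitions⁺ : ∀ m {l} → Strict l → length l ≡ m → l ∈ strictPartitions m (sum l)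
  ∈-strictPartitions⁺ zero [] refl = here refl
  ∈-strictPartitions⁺ (suc m) {l@(x ∷ xs)} strict |l|≡1+m =
    ∈-concatMap⁺ (λ c → map (extend c) (strictPartitions m (sum l ∸ suc c * suc m)))
      (lose (∈-blockCounts⁺ k≤sum) (subst (_∈ map (extend c) (strictPartitions m (sum l ∸ k))) (extend-shrink strict smallest≡1+c)
                                          (∈-map⁺ (extend c) r∈)))
    where
    c : ℕ
    c = pred (smallest l)
    smallest≡1+c : smallest l ≡ suc c
    smallest≡1+c = sym (suc-pred (smallest l) {{>-nonZero (smallest-positive strict)}})
    k : ℕ
    k = suc c * suc m
    r : List ℕ
    r = shrink c l
    |r|≡m : length r ≡ m
    |r|≡m = trans (length-shrink strict smallest≡1+c) (suc-injective |l|≡1+m)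
    sum-l : sum l ≡ k + sum r
    sum-l = begin
      sum l                                ≡⟨ cong sum (extend-shrink strict smallest≡1+c) ⟨
      sum (extend c r)                     ≡⟨ sum-extend c r ⟩
      suc c * suc (length r) + sum r       ≡⟨ cong (λ j → suc c * suc j + sum r) |r|≡m ⟩
      k + sum r                            ∎
      where open ≡-Reasoning
    k≤sum : k ≤ sum l
    k≤sum = subst (k ≤_) (sym sum-l) (m≤m+n k (sum r))
    r∈ : r ∈ strictPartitions m (sum l ∸ k)
    r∈ = subst (λ j → r ∈ strictPartitions m j) (trans (sym (m+n∸m≡n k (sum r))) (cong (_∸ k) (sym sum-l)))
           (∈-strictPartitions⁺ m (Strict-shrink strict smallest≡1+c) |r|≡m)

  Unique-strictPartitions : ∀ m n → Unique (strictPartitions m n)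
  Unique-strictPartitions zero zero = [] ∷ []
  Unique-strictPartitions zero (suc n) = []
  Unique-strictPartitions (suc m) n =
    Unique-concatMap (λ c → map (extend c) (strictPartitions m (n ∸ suc c * suc m)))
      (filter⁺ (λ c → T? (suc c * suc m ≤ᵇ n)) (upTo⁺ n))
      (λ c → map⁺ (extend-injective c) (Unique-strictPartitions m _))
      (λ l∈ l∈′ → suc-injective (trans (sym (smallest-of l∈)) (smallest-of l∈′)))
    where
    smallest-of : ∀ {c l} → l ∈ map (extend c) (strictPartitions m (n ∸ suc c * suc m)) → smallest l ≡ suc c
    smallest-of {c} l∈ with ∈-map⁻ (extend c) l∈
    ... | r , _ , refl = smallest-∷ʳ (map (suc c +_) r) (suc c)

  strictPartitions≤ : ℕ → ℕ → List (List ℕ)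
  strictPartitions≤ zero n = strictPartitions zero n
  strictPartitions≤ (suc M) n = strictPartitions≤ M n ++ strictPartitions (suc M) n

  ∈-strictPartitions≤⁻ : ∀ M n {l} → l ∈ strictPartitions≤ M n → Strict l × length l ≤ M × sum l ≡ n
  ∈-strictPartitions≤⁻ zero n l∈ with ∈-strictPartitions⁻ zero n l∈
  ... | strict , |l|≡0 , sum-l = strict , ≤-reflexive |l|≡0 , sum-l
  ∈-strictPartitions≤⁻ (suc M) n l∈ with ∈-++⁻ (strictPartitions≤ M n) l∈
  ... | inj₁ l∈≤M with ∈-strictPartitions≤⁻ M n l∈≤M
  ...   | strict , |l|≤M , sum-l = strict , m≤n⇒m≤1+n |l|≤M , sum-l
  ∈-strictPartitions≤⁻ (suc M) n l∈ | inj₂ l∈M+1 with ∈-strictPartitions⁻ (suc M) n l∈M+1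
  ...   | strict , |l|≡1+M , sum-l = strict , ≤-reflexive |l|≡1+M , sum-l

  ∈-strictPartitions≤⁺ : ∀ M {l} → Strict l → length l ≤ M → l ∈ strictPartitions≤ M (sum l)
  ∈-strictPartitions≤⁺ zero strict |l|≤0 = ∈-strictPartitions⁺ zero strict (n≤0⇒n≡0 |l|≤0)
  ∈-strictPartitions≤⁺ (suc M) strict |l|≤1+M with m≤n⇒m<n∨m≡n |l|≤1+M
  ... | inj₁ |l|<1+M = ∈-++⁺ˡ (∈-strictPartitions≤⁺ M strict (≤-pred |l|<1+M))
  ... | inj₂ |l|≡1+M = ∈-++⁺ʳ (strictPartitions≤ M _) (∈-strictPartitions⁺ (suc M) strict |l|≡1+M)

  Unique-strictPartitions≤ : ∀ M n → Unique (strictPartitions≤ M n)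
  Unique-strictPartitions≤ zero n = Unique-strictPartitions zero n
  Unique-strictPartitions≤ (suc M) n = ++⁺ (Unique-strictPartitions≤ M n) (Unique-strictPartitions (suc M) n) apart
    where
    apart : ∀ {l} → ¬ (l ∈ strictPartitions≤ M n × l ∈ strictPartitions (suc M) n)
    apart (l∈≤M , l∈M+1) with ∈-strictPartitions≤⁻ M n l∈≤M | ∈-strictPartitions⁻ (suc M) n l∈M+1
    ... | _ , |l|≤M , _ | _ , |l|≡1+M , _ = 1+n≰n (subst (_≤ M) |l|≡1+M |l|≤M)

  length≤sum : ∀ {l} → Strict l → length l ≤ sum l
  length≤sum [] = z≤n
  length≤sum [ 0<x ] = subst (1 ≤_) (sym (+-identityʳ _)) 0<x
  length≤sum (y<x ∷ s) = +-mono-≤ (<-≤-trans z<s y<x) (length≤sum s)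

  strictPartitions-even : ∀ n → ¬ IsPentagonal n → 2 ∣ length (strictPartitions≤ n n)
  strictPartitions-even n not-pentagonal =
    even-length-of-involution (≡-dec _≟_) franklin (length partitions) partitions ≤-refl (Unique-strictPartitions≤ n n)
      closed (FranklinPartner.involutive ∘ partner) (λ l∈ → FranklinPartner.length-changed (partner l∈) ∘ cong length)
    where
    partitions : List (List ℕ)
    partitions = strictPartitions≤ n n
    partner : ∀ {l} → l ∈ partitions → FranklinPartner l
    partner l∈ with ∈-strictPartitions≤⁻ n n l∈
    ... | strict , _ , refl = franklin-partner strict (not-pentagonal ∘ exceptional⇒pentagonal strict)
    closed : ∀ {l} → l ∈ partitions → franklin l ∈ partitions
    closed {l} l∈ with ∈-strictPartitions≤⁻ n n l∈
    ... | _ , _ , sum-l = subst (λ j → franklin l ∈ strictPartitions≤ n j) sum-franklin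
                            (∈-strictPartitions≤⁺ n strict (subst (length (franklin l) ≤_) sum-franklin (length≤sum strict)))
      where
      open FranklinPartner (partner l∈)
      sum-franklin : sum (franklin l) ≡ n
      sum-franklin = trans sum-preserved sum-l

  -- The mex-hat of an overpartition

  ≡ᵇ-refl : ∀ n → (n ≡ᵇ n) ≡ true
  ≡ᵇ-refl zero = refl
  ≡ᵇ-refl (suc n) = ≡ᵇ-refl n

  ≢⇒≡ᵇ-false : ∀ m n → m ≢ n → (m ≡ᵇ n) ≡ false
  ≢⇒≡ᵇ-false m n m≢n with m ≡ᵇ n in eq
  ... | false = refl
  ... | true = ⊥-elim (m≢n (≡ᵇ⇒≡ m n (subst T (sym eq) tt)))

  -- The c + 1 copies of the part m + 1 that overpartitionsBounded (suc m) n puts in front.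
  block : ℕ → Bool → ℕ → Overpartition
  block m b c = (suc m , b) ∷ replicate c (suc m , false)

  PartsAtMost : ℕ → Overpartition → Set
  PartsAtMost m = All ((_≤ m) ∘ proj₁)

  isOverlinedPart-++ : ∀ k xs ys → isOverlinedPart k (xs ++ ys) ≡ isOverlinedPart k xs ∨ isOverlinedPart k ys
  isOverlinedPart-++ k [] ys = refl
  isOverlinedPart-++ k ((a , b) ∷ xs) ys =
    trans (cong ((a ≡ᵇ k) ∧ b ∨_) (isOverlinedPart-++ k xs ys)) (sym (∨-assoc ((a ≡ᵇ k) ∧ b) _ _))

  isOverlinedPart-block : ∀ k m b c rest → isOverlinedPart k (block m b c ++ rest) ≡ (suc m ≡ᵇ k) ∧ b ∨ isOverlinedPart k rest
  isOverlinedPart-block k m b c rest = cong ((suc m ≡ᵇ k) ∧ b ∨_)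
    (trans (isOverlinedPart-++ k (replicate c (suc m , false)) rest) (cong (_∨ isOverlinedPart k rest) (plain c)))
    where
    plain : ∀ c → isOverlinedPart k (replicate c (suc m , false)) ≡ false
    plain zero = refl
    plain (suc c) = trans (cong (_∨ isOverlinedPart k (replicate c (suc m , false))) (∧-zeroʳ (suc m ≡ᵇ k))) (plain c)

  isOverlinedPart-large : ∀ {k m π} → PartsAtMost m π → m < k → isOverlinedPart k π ≡ false
  isOverlinedPart-large [] _ = refl
  isOverlinedPart-large {k} {π = (a , b) ∷ π} (a≤m ∷ rest) m<k =
    trans (cong (λ e → e ∧ b ∨ isOverlinedPart k π) (≢⇒≡ᵇ-false a k (λ a≡k → <-irrefl a≡k (≤-<-trans a≤m m<k))))
          (isOverlinedPart-large rest m<k)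

  mexHatFrom-spec : ∀ fuel k v π → k ≤ v → v < k + fuel →
    (∀ j → k ≤ j → j < v → isOverlinedPart j π ≡ true) → isOverlinedPart v π ≡ false → mexHatFrom fuel k π ≡ v
  mexHatFrom-spec zero k v π k≤v v<k+0 _ _ = ⊥-elim (<⇒≱ (subst (v <_) (+-identityʳ k) v<k+0) k≤v)
  mexHatFrom-spec (suc fuel) k v π k≤v v<k+fuel below not-v with m≤n⇒m<n∨m≡n k≤v
  ... | inj₂ refl rewrite not-v = refl
  ... | inj₁ k<v rewrite below k ≤-refl k<v =
    mexHatFrom-spec fuel (suc k) v π k<v (subst (v <_) (+-suc k fuel) v<k+fuel) (λ j k<j j<v → below j (<⇒≤ k<j) j<v) not-v

  -- The bound v ≤ 1 + length π is what the fuel of mexHat's search needs.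
  record MexWitness (m : ℕ) (π : Overpartition) (v : ℕ) : Set where
    field
      parts≤ : PartsAtMost m π
      overlined-below : ∀ j → 1 ≤ j → j < v → isOverlinedPart j π ≡ true
      not-overlined : isOverlinedPart v π ≡ false
      1≤v : 1 ≤ v
      v≤1+|π| : v ≤ suc (length π)

  module _ {m π v} (w : MexWitness m π v) where
    open MexWitness w

    MexWitness⇒mexHat : mexHat π ≡ v
    MexWitness⇒mexHat = mexHatFrom-spec (suc (length π)) 1 v π 1≤v (s≤s v≤1+|π|) overlined-below not-overlined

    MexWitness⇒≤ : v ≤ suc m
    MexWitness⇒≤ with v ≤? suc m
    ... | yes v≤1+m = v≤1+m
    ... | no v≰1+m =
      contradiction (trans (sym (overlined-below (suc m) (s≤s z≤n) (≰⇒> v≰1+m))) (isOverlinedPart-large parts≤ ≤-refl)) λ ()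

    MexWitness-weaken : MexWitness (suc m) π v
    MexWitness-weaken = record { MexWitness w ; parts≤ = All.map m≤n⇒m≤1+n parts≤ }

  -- [ v ≡ m + 1 ]: a mex-hat of m + 1 means that all of 1, …, m are overlined.
  isFull : ℕ → ℕ → ℕ
  isFull m v with v ≟ suc m
  ... | yes _ = 1
  ... | no _ = 0

  PartsAtMost-block : ∀ {m rest} b c → PartsAtMost m rest → PartsAtMost (suc m) (block m b c ++ rest)
  PartsAtMost-block {m} b c parts≤ = ≤-refl ∷ copies c
    where
    copies : ∀ c → PartsAtMost (suc m) (replicate c (suc m , false) ++ _)
    copies zero = All.map m≤n⇒m≤1+n parts≤
    copies (suc c) = ≤-refl ∷ copies c

  length-block : ∀ m b c rest → length (block m b c ++ rest) ≡ suc (c + length rest)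
  length-block m b c rest = cong suc (trans (length-++ (replicate c (suc m , false))) (cong (_+ length rest) (length-replicate c)))

  ≤-length-block : ∀ m b c rest {v} → v ≤ suc (length rest) → v ≤ suc (length (block m b c ++ rest))
  ≤-length-block m b c rest v≤ =
    ≤-trans v≤ (s≤s (subst (length rest ≤_) (sym (length-block m b c rest)) (≤-trans (m≤n+m _ c) (n≤1+n _))))

  module _ {m rest v} (w : MexWitness m rest v) (c : ℕ) where
    open MexWitness w

    MexWitness-plain : MexWitness (suc m) (block m false c ++ rest) v
    MexWitness-plain = record
      { parts≤ = PartsAtMost-block false c parts≤
      ; overlined-below = λ j 1≤j j<v → trans (unchanged j) (overlined-below j 1≤j j<v)
      ; not-overlined = trans (unchanged v) not-overlined
      ; 1≤v = 1≤v
      ; v≤1+|π| = ≤-length-block m false c rest v≤1+|π|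
      }
      where
      unchanged : ∀ j → isOverlinedPart j (block m false c ++ rest) ≡ isOverlinedPart j rest
      unchanged j = trans (isOverlinedPart-block j m false c rest) (cong (_∨ isOverlinedPart j rest) (∧-zeroʳ (suc m ≡ᵇ j)))

    private
      overlined-block : ∀ j → isOverlinedPart j (block m true c ++ rest) ≡ (suc m ≡ᵇ j) ∨ isOverlinedPart j rest
      overlined-block j = trans (isOverlinedPart-block j m true c rest) (cong (_∨ isOverlinedPart j rest) (∧-identityʳ (suc m ≡ᵇ j)))

    MexWitness-overlined : MexWitness (suc m) (block m true c ++ rest) (isFull m v + v)
    MexWitness-overlined with v ≟ suc m
    ... | yes refl = record
      { parts≤ = PartsAtMost-block true c parts≤
      ; overlined-below = below
      ; not-overlined = trans (overlined-block (2 + m))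
          (cong₂ _∨_ (≢⇒≡ᵇ-false (suc m) (2 + m) (1+n≢n ∘ sym)) (isOverlinedPart-large parts≤ (m<n⇒m<1+n (n<1+n m))))
      ; 1≤v = s≤s z≤n
      ; v≤1+|π| = s≤s (subst (suc m ≤_) (sym (length-block m true c rest)) (≤-trans v≤1+|π| (s≤s (m≤n+m _ c))))
      }
      where
      below : ∀ j → 1 ≤ j → j < 2 + m → isOverlinedPart j (block m true c ++ rest) ≡ true
      below j 1≤j j<2+m with j ≟ suc m
      ... | yes refl = trans (overlined-block j) (cong (_∨ isOverlinedPart j rest) (≡ᵇ-refl j))
      ... | no j≢1+m = trans (overlined-block j)
                         (trans (cong ((suc m ≡ᵇ j) ∨_) (overlined-below j 1≤j (≤∧≢⇒< (≤-pred j<2+m) j≢1+m))) (∨-zeroʳ _))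
    ... | no v≢1+m = record
      { parts≤ = PartsAtMost-block true c parts≤
      ; overlined-below = λ j 1≤j j<v →
          trans (overlined-block j) (trans (cong ((suc m ≡ᵇ j) ∨_) (overlined-below j 1≤j j<v)) (∨-zeroʳ _))
      ; not-overlined = trans (overlined-block v) (cong₂ _∨_ (≢⇒≡ᵇ-false (suc m) v (v≢1+m ∘ sym)) not-overlined)
      ; 1≤v = 1≤v
      ; v≤1+|π| = ≤-length-block m true c rest v≤1+|π|
      }

  blockExtensions : ℕ → ℕ → ℕ → Bool → List Overpartition
  blockExtensions m n c b = map (block m b c ++_) (overpartitionsBounded m (n ∸ suc c * suc m))

  overpartitionsBounded-witness : ∀ m n {π} → π ∈ overpartitionsBounded m n → ∃ (MexWitness m π)
  overpartitionsBounded-witness zero zero (here refl) =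
    1 , record
      { parts≤ = []
      ; overlined-below = λ j 1≤j j<1 → ⊥-elim (<⇒≱ j<1 1≤j)
      ; not-overlined = refl
      ; 1≤v = ≤-refl
      ; v≤1+|π| = ≤-refl
      }
  overpartitionsBounded-witness (suc m) n π∈ with ∈-++⁻ (overpartitionsBounded m n) π∈
  ... | inj₁ π∈old = map₂ MexWitness-weaken (overpartitionsBounded-witness m n π∈old)
  ... | inj₂ π∈new with find (∈-concatMap⁻ (λ c → concatMap (blockExtensions m n c) (false ∷ true ∷ [])) {xs = blockCounts m n} π∈new)
  ...   | c , _ , π∈c with find (∈-concatMap⁻ (blockExtensions m n c) {xs = false ∷ true ∷ []} π∈c)
  ...     | b , _ , π∈cb with ∈-map⁻ (block m b c ++_) π∈cb
  ...       | rest , rest∈ , refl with overpartitionsBounded-witness m _ rest∈ | b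
  ...         | v , w | false = v , MexWitness-plain w c
  ...         | v , w | true = isFull m v + v , MexWitness-overlined w c

  module _ (m r : ℕ) {rest : Overpartition} (rest∈ : rest ∈ overpartitionsBounded m r) where
    private
      v : ℕ
      v = proj₁ (overpartitionsBounded-witness m r rest∈)
      w : MexWitness m rest v
      w = proj₂ (overpartitionsBounded-witness m r rest∈)

    mexHat-≤ : mexHat rest ≤ suc m
    mexHat-≤ = subst (_≤ suc m) (sym (MexWitness⇒mexHat w)) (MexWitness⇒≤ w)

    mexHat-plain : ∀ c → mexHat (block m false c ++ rest) ≡ mexHat rest
    mexHat-plain c = trans (MexWitness⇒mexHat (MexWitness-plain w c)) (sym (MexWitness⇒mexHat w))

    mexHat-overlined : ∀ c → mexHat (block m true c ++ rest) ≡ isFull m (mexHat rest) + mexHat rest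
    mexHat-overlined c = trans (MexWitness⇒mexHat (MexWitness-overlined w c)) (cong (λ u → isFull m u + u) (sym (MexWitness⇒mexHat w)))

  -- σmex modulo 2

  ∑-overpartitionsBounded-suc : ∀ m n (f : Overpartition → ℕ) →
    ∑ (overpartitionsBounded (suc m) n) f ≡
      ∑ (overpartitionsBounded m n) f +
      ∑[ c ∈ blockCounts m n ] (∑[ rest ∈ overpartitionsBounded m (n ∸ suc c * suc m) ] f (block m false c ++ rest)
                              + ∑[ rest ∈ overpartitionsBounded m (n ∸ suc c * suc m) ] f (block m true c ++ rest))
  ∑-overpartitionsBounded-suc m n f = begin
    ∑ (overpartitionsBounded (suc m) n) f
      ≡⟨ ∑-++ (overpartitionsBounded m n) _ f ⟩
    ∑ (overpartitionsBounded m n) f + ∑ (concatMap extensions (blockCounts m n)) f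
      ≡⟨ cong (∑ (overpartitionsBounded m n) f +_) (∑-concatMap extensions (blockCounts m n) f) ⟩
    ∑ (overpartitionsBounded m n) f + ∑[ c ∈ blockCounts m n ] ∑ (extensions c) f
      ≡⟨ cong (∑ (overpartitionsBounded m n) f +_) (∑-cong (blockCounts m n) (λ {c} _ → plain+overlined c)) ⟩
    ∑ (overpartitionsBounded m n) f + ∑[ c ∈ blockCounts m n ] (withBlock false c + withBlock true c) ∎
    where
    open ≡-Reasoning
    extensions : ℕ → List Overpartition
    extensions c = concatMap (blockExtensions m n c) (false ∷ true ∷ [])
    withBlock : Bool → ℕ → ℕ
    withBlock b c = ∑[ rest ∈ overpartitionsBounded m (n ∸ suc c * suc m) ] f (block m b c ++ rest)
    plain+overlined : ∀ c → ∑ (extensions c) f ≡ withBlock false c + withBlock true c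
    plain+overlined c = begin
      ∑ (extensions c) f
        ≡⟨ ∑-concatMap (blockExtensions m n c) (false ∷ true ∷ []) f ⟩
      ∑ (blockExtensions m n c false) f + (∑ (blockExtensions m n c true) f + 0)
        ≡⟨ cong₂ (λ a b → a + (b + 0)) (∑-map (block m false c ++_) rests f) (∑-map (block m true c ++_) rests f) ⟩
      withBlock false c + (withBlock true c + 0)
        ≡⟨ cong (withBlock false c +_) (+-identityʳ _) ⟩
      withBlock false c + withBlock true c ∎
      where
      rests : List Overpartition
      rests = overpartitionsBounded m (n ∸ suc c * suc m)

  mexSum : ℕ → ℕ → ℕ
  mexSum m n = ∑[ π ∈ overpartitionsBounded m n ] mexHat π

  fullCount : ℕ → ℕ → ℕ
  fullCount m n = ∑[ π ∈ overpartitionsBounded m n ] isFull m (mexHat π)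

  isFull-≤ : ∀ m v → v ≤ suc m → isFull (suc m) v ≡ 0
  isFull-≤ m v v≤1+m with v ≟ suc (suc m)
  ... | yes refl = ⊥-elim (1+n≰n v≤1+m)
  ... | no _ = refl

  isFull-suc : ∀ m v → v ≤ suc m → isFull (suc m) (isFull m v + v) ≡ isFull m v
  isFull-suc m v v≤1+m with v ≟ suc m
  ... | no _ = isFull-≤ m v v≤1+m
  ... | yes refl with suc (suc m) ≟ suc (suc m)
  ...   | yes _ = refl
  ...   | no m+2≢m+2 = ⊥-elim (m+2≢m+2 refl)

  -- The plain and the overlined block both contribute the mex-hats of the rests;
  -- the overlined one adds 1 for each full rest.
  mexSum-suc : ∀ m n → mexSum (suc m) n ≡
    mexSum m n + ∑[ c ∈ blockCounts m n ] (fullCount m (n ∸ suc c * suc m) + (mexSum m (n ∸ suc c * suc m) + mexSum m (n ∸ suc c * suc m)))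
  mexSum-suc m n = trans (∑-overpartitionsBounded-suc m n mexHat) (cong (mexSum m n +_) (∑-cong (blockCounts m n) (λ {c} _ → blocks c)))
    where
    blocks : ∀ c → let rests = overpartitionsBounded m (n ∸ suc c * suc m) in
      ∑[ rest ∈ rests ] mexHat (block m false c ++ rest) + ∑[ rest ∈ rests ] mexHat (block m true c ++ rest)
        ≡ fullCount m (n ∸ suc c * suc m) + (mexSum m (n ∸ suc c * suc m) + mexSum m (n ∸ suc c * suc m))
    blocks c = begin
      ∑[ rest ∈ rests ] mexHat (block m false c ++ rest) + ∑[ rest ∈ rests ] mexHat (block m true c ++ rest)
        ≡⟨ cong₂ _+_ (∑-cong rests (λ rest∈ → mexHat-plain m r rest∈ c)) (∑-cong rests (λ rest∈ → mexHat-overlined m r rest∈ c)) ⟩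
      mexSum m r + ∑[ rest ∈ rests ] (isFull m (mexHat rest) + mexHat rest)
        ≡⟨ cong (mexSum m r +_) (∑-+ rests (isFull m ∘ mexHat) mexHat) ⟩
      mexSum m r + (fullCount m r + mexSum m r)
        ≡⟨ x∙yz≈y∙xz (mexSum m r) (fullCount m r) (mexSum m r) ⟩
      fullCount m r + (mexSum m r + mexSum m r) ∎
      where
      open ≡-Reasoning
      r : ℕ
      r = n ∸ suc c * suc m
      rests : List Overpartition
      rests = overpartitionsBounded m r

  fullCount-suc : ∀ m n → fullCount (suc m) n ≡ ∑[ c ∈ blockCounts m n ] fullCount m (n ∸ suc c * suc m)
  fullCount-suc m n = begin
    fullCount (suc m) n
      ≡⟨ ∑-overpartitionsBounded-suc m n (isFull (suc m) ∘ mexHat) ⟩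
    ∑[ π ∈ overpartitionsBounded m n ] isFull (suc m) (mexHat π) + ∑[ c ∈ blockCounts m n ] (withBlock false c + withBlock true c)
      ≡⟨ cong₂ _+_ old (∑-cong (blockCounts m n) (λ {c} _ → blocks c)) ⟩
    0 + ∑[ c ∈ blockCounts m n ] fullCount m (n ∸ suc c * suc m) ∎
    where
    open ≡-Reasoning
    old : ∑[ π ∈ overpartitionsBounded m n ] isFull (suc m) (mexHat π) ≡ 0
    old = trans (∑-cong (overpartitionsBounded m n) (λ π∈ → isFull-≤ m _ (mexHat-≤ m n π∈))) (∑-zero (overpartitionsBounded m n))
    withBlock : Bool → ℕ → ℕ
    withBlock b c = ∑[ rest ∈ overpartitionsBounded m (n ∸ suc c * suc m) ] isFull (suc m) (mexHat (block m b c ++ rest))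
    blocks : ∀ c → withBlock false c + withBlock true c ≡ fullCount m (n ∸ suc c * suc m)
    blocks c = cong₂ _+_
      (trans (∑-cong rests (λ rest∈ → trans (cong (isFull (suc m)) (mexHat-plain m r rest∈ c)) (isFull-≤ m _ (mexHat-≤ m r rest∈))))
             (∑-zero rests))
      (∑-cong rests (λ rest∈ → trans (cong (isFull (suc m)) (mexHat-overlined m r rest∈ c)) (isFull-suc m _ (mexHat-≤ m r rest∈))))
      where
      r : ℕ
      r = n ∸ suc c * suc m
      rests : List Overpartition
      rests = overpartitionsBounded m r

  fullCount≡length : ∀ m n → fullCount m n ≡ length (strictPartitions m n)
  fullCount≡length zero zero = refl
  fullCount≡length zero (suc n) = refl
  fullCount≡length (suc m) n = begin
    fullCount (suc m) n
      ≡⟨ fullCount-suc m n ⟩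
    ∑[ c ∈ blockCounts m n ] fullCount m (n ∸ suc c * suc m)
      ≡⟨ ∑-cong (blockCounts m n) (λ {c} _ → trans (fullCount≡length m (n ∸ suc c * suc m))
                                                   (sym (length-map (extend c) (strictPartitions m (n ∸ suc c * suc m))))) ⟩
    ∑[ c ∈ blockCounts m n ] length (map (extend c) (strictPartitions m (n ∸ suc c * suc m)))
      ≡⟨ length-concatMap (λ c → map (extend c) (strictPartitions m (n ∸ suc c * suc m))) (blockCounts m n) ⟨
    length (strictPartitions (suc m) n) ∎
    where open ≡-Reasoning

  mexSum≡strictPartitions-mod-2 : ∀ M n → ∃ λ t → mexSum M n ≡ length (strictPartitions≤ M n) + 2 * t
  mexSum≡strictPartitions-mod-2 zero zero = 0 , refl
  mexSum≡strictPartitions-mod-2 zero (suc n) = 0 , refl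
  mexSum≡strictPartitions-mod-2 (suc M) n with mexSum≡strictPartitions-mod-2 M n
  ... | t , mexSum≡ = t + ∑ cs S , (begin
    mexSum (suc M) n                                ≡⟨ mexSum-suc M n ⟩
    mexSum M n + ∑[ c ∈ cs ] (H c + (S c + S c))    ≡⟨ cong₂ _+_ mexSum≡ (trans (∑-+ cs H _) (cong (∑ cs H +_) (∑-+ cs S S))) ⟩
    L + 2 * t + (∑ cs H + (∑ cs S + ∑ cs S))        ≡⟨ rearrange L t (∑ cs H) (∑ cs S) ⟩
    L + ∑ cs H + 2 * (t + ∑ cs S)                   ≡⟨ cong (λ h → L + h + 2 * (t + ∑ cs S)) full ⟩
    L + length (strictPartitions (suc M) n) + 2 * (t + ∑ cs S)
                                                    ≡⟨ cong (_+ 2 * (t + ∑ cs S)) (length-++ (strictPartitions≤ M n)) ⟨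
    length (strictPartitions≤ (suc M) n) + 2 * (t + ∑ cs S) ∎)
    where
    open ≡-Reasoning
    cs : List ℕ
    cs = blockCounts M n
    L : ℕ
    L = length (strictPartitions≤ M n)
    S H : ℕ → ℕ
    S c = mexSum M (n ∸ suc c * suc M)
    H c = fullCount M (n ∸ suc c * suc M)
    full : ∑ cs H ≡ length (strictPartitions (suc M) n)
    full = trans (sym (fullCount-suc M n)) (fullCount≡length (suc M) n)
    rearrange : ∀ l t h s → l + 2 * t + (h + (s + s)) ≡ l + h + 2 * (t + s)
    rearrange = solve-∀

  2∣⇒isEven : ∀ {n} → 2 ∣ n → isEven n ≡ true
  2∣⇒isEven (divides q refl) = isEven-*2 q
    where
    isEven-*2 : ∀ q → isEven (q * 2) ≡ true
    isEven-*2 zero = refl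
    isEven-*2 (suc q) = isEven-*2 q

  σmex-even : ∀ n → ¬ IsPentagonal n → isEven (σmex n) ≡ true
  σmex-even zero not-pentagonal = ⊥-elim (not-pentagonal (0 , inj₁ refl))
  σmex-even n@(suc _) not-pentagonal with mexSum≡strictPartitions-mod-2 n n
  ... | t , σmex≡ = 2∣⇒isEven (subst (2 ∣_) (sym σmex≡) (∣m∣n⇒∣m+n (strictPartitions-even n not-pentagonal) (m∣m*n t)))

  -- Pentagonal numbers are sparse

  m*m≤pentagonal⁻ : ∀ m → m * m ≤ pentagonal⁻ m
  m*m≤pentagonal⁻ m = m*s≤sum-run m m
    where
    m*s≤sum-run : ∀ s m → m * s ≤ sum (run s m)
    m*s≤sum-run s zero = z≤n
    m*s≤sum-run s (suc m) = +-mono-≤ (m≤n+m s m) (m*s≤sum-run s m)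

  pentagonal⁻≤pentagonal⁺ : ∀ m → pentagonal⁻ m ≤ pentagonal⁺ m
  pentagonal⁻≤pentagonal⁺ m = run-mono m
    where
    run-mono : ∀ k → sum (run m k) ≤ sum (run (suc m) k)
    run-mono zero = z≤n
    run-mono (suc k) = +-mono-≤ (+-monoʳ-≤ k (n≤1+n m)) (run-mono k)

  pentagonal-≥ : ∀ {n} → ((m , _) : IsPentagonal n) → m * m ≤ n
  pentagonal-≥ (m , inj₁ refl) = m*m≤pentagonal⁻ m
  pentagonal-≥ (m , inj₂ refl) = ≤-trans (m*m≤pentagonal⁻ m) (pentagonal⁻≤pentagonal⁺ m)

  pentagonalBelow : ℕ → ℕ → Bool
  pentagonalBelow zero n = false
  pentagonalBelow (suc K) n = pentagonalBelow K n ∨ (n ≡ᵇ pentagonal⁻ K) ∨ (n ≡ᵇ pentagonal⁺ K)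

  pentagonalBelow-sound : ∀ K {n} → T (pentagonalBelow K n) → IsPentagonal n
  pentagonalBelow-sound (suc K) {n} found with Equivalence.to T-∨ found
  ... | inj₁ below = pentagonalBelow-sound K below
  ... | inj₂ at-K with Equivalence.to T-∨ at-K
  ...   | inj₁ n≡ = K , inj₁ (≡ᵇ⇒≡ n _ n≡)
  ...   | inj₂ n≡ = K , inj₂ (≡ᵇ⇒≡ n _ n≡)

  pentagonalBelow-complete : ∀ K {n} ((m , _) : IsPentagonal n) → m < K → T (pentagonalBelow K n)
  pentagonalBelow-complete (suc K) {n} (m , n≡) m<1+K with m≤n⇒m<n∨m≡n (≤-pred m<1+K)
  ... | inj₁ m<K = Equivalence.from T-∨ (inj₁ (pentagonalBelow-complete K (m , n≡) m<K))
  ... | inj₂ refl =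
    Equivalence.from (T-∨ {pentagonalBelow m n}) (inj₂ (Equivalence.from T-∨ (Sum.map (≡⇒≡ᵇ n _) (≡⇒≡ᵇ n _) n≡)))

  m≤m*m : ∀ m → m ≤ m * m
  m≤m*m zero = z≤n
  m≤m*m (suc m) = m≤m*n (suc m) (suc m)

  σmex-odd⇒pentagonal : ∀ n → isEven (σmex n) ≡ false → IsPentagonal n
  σmex-odd⇒pentagonal n odd with T? (pentagonalBelow (suc n) n)
  ... | yes found = pentagonalBelow-sound (suc n) found
  ... | no none = contradiction (trans (sym (σmex-even n not-pentagonal)) odd) λ ()
    where
    not-pentagonal : ¬ IsPentagonal n
    not-pentagonal p = none (pentagonalBelow-complete (suc n) p (s≤s (≤-trans (m≤m*m (proj₁ p)) (pentagonal-≥ p))))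

  length-filterᵇ-pentagonalBelow : ∀ K {xs} → Unique xs → length (filterᵇ (pentagonalBelow K) xs) ≤ 2 * K
  length-filterᵇ-pentagonalBelow zero {xs} _ =
    ≤-reflexive (cong length (filter-none (T? ∘ pentagonalBelow 0) {xs = xs} (All.tabulate (λ _ ()))))
  length-filterᵇ-pentagonalBelow (suc K) {xs} u = begin
    length (filterᵇ (pentagonalBelow (suc K)) xs)
      ≤⟨ length-filterᵇ-∨ (pentagonalBelow K) (λ n → (n ≡ᵇ pentagonal⁻ K) ∨ (n ≡ᵇ pentagonal⁺ K)) xs ⟩
    length (filterᵇ (pentagonalBelow K) xs) + length (filterᵇ (λ n → (n ≡ᵇ pentagonal⁻ K) ∨ (n ≡ᵇ pentagonal⁺ K)) xs)
      ≤⟨ +-mono-≤ (length-filterᵇ-pentagonalBelow K u)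
                  (≤-trans (length-filterᵇ-∨ (_≡ᵇ pentagonal⁻ K) (_≡ᵇ pentagonal⁺ K) xs)
                           (+-mono-≤ (length-filterᵇ-≡ᵇ (pentagonal⁻ K) u) (length-filterᵇ-≡ᵇ (pentagonal⁺ K) u))) ⟩
    2 * K + 2
      ≡⟨ +-comm (2 * K) 2 ⟩
    2 + 2 * K
      ≡⟨ *-suc 2 K ⟨
    2 * suc K ∎
    where open ≤-Reasoning

  oddCount : ℕ → ℕ
  oddCount X = length (filterᵇ (not ∘ isEven ∘ σmex) (upTo (suc X)))

  evenCount+oddCount : ∀ X → evenCount X + oddCount X ≡ suc X
  evenCount+oddCount X = trans (length-filterᵇ-complement (isEven ∘ σmex) (upTo (suc X))) (length-upTo (suc X))

  m*m≤o∧n*n≤o⇒m*n≤o : ∀ m n {o} → m * m ≤ o → n * n ≤ o → m * n ≤ o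
  m*m≤o∧n*n≤o⇒m*n≤o m n m*m≤o n*n≤o with ≤-total m n
  ... | inj₁ m≤n = ≤-trans (*-monoˡ-≤ n m≤n) n*n≤o
  ... | inj₂ n≤m = ≤-trans (*-monoʳ-≤ m n≤m) m*m≤o

  -- An odd σmex n forces n = pentagonal∓ m with m * m ≤ n ≤ X, hence m ≤ X / C.
  oddCount-≤ : ∀ C X .{{_ : NonZero C}} → C * C ≤ X → oddCount X ≤ 2 * suc (X / C)
  oddCount-≤ C X C*C≤X =
    ≤-trans (length-filterᵇ-mono (upTo (suc X)) odd⇒pentagonalBelow)
            (length-filterᵇ-pentagonalBelow (suc (X / C)) (upTo⁺ (suc X)))
    where
    odd⇒pentagonalBelow : ∀ {n} → n ∈ upTo (suc X) → T (not (isEven (σmex n))) → T (pentagonalBelow (suc (X / C)) n)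
    odd⇒pentagonalBelow {n} n∈ odd = pentagonalBelow-complete (suc (X / C)) p (s≤s m≤X/C)
      where
      p : IsPentagonal n
      p = σmex-odd⇒pentagonal n (Equivalence.to T-not-≡ odd)
      m : ℕ
      m = proj₁ p
      m*C≤X : m * C ≤ X
      m*C≤X = m*m≤o∧n*n≤o⇒m*n≤o m C (≤-trans (pentagonal-≥ p) (≤-pred (∈-upTo⁻ n∈))) C*C≤X
      m≤X/C : m ≤ X / C
      m≤X/C = subst (_≤ X / C) (m*n/n≡m m C) (/-monoˡ-≤ C m*C≤X)

  oddCount-small : ∀ d X → (8 * suc d) * (8 * suc d) ≤ X → suc (oddCount X) * suc d < X
  oddCount-small d X C*C≤X = *-cancelʳ-< _ (suc (oddCount X) * D) X (begin-strict
    suc O * D * 8                   ≡⟨ regroup O D ⟩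
    suc O * C                       ≤⟨ *-monoˡ-≤ C (s≤s (oddCount-≤ C X C*C≤X)) ⟩
    suc (2 * suc K) * C             ≡⟨ expand K C ⟩
    3 * C + 2 * (K * C)             ≤⟨ +-mono-≤ (*-monoʳ-≤ 3 C≤X) (*-monoʳ-≤ 2 (m/n*n≤m X C)) ⟩
    3 * X + 2 * X                   <⟨ m<m+n (3 * X + 2 * X) (*-monoʳ-< 3 (<-≤-trans (>-nonZero⁻¹ C) C≤X)) ⟩
    3 * X + 2 * X + 3 * X           ≡⟨ collect X ⟩
    X * 8                           ∎)
    where
    open ≤-Reasoning
    D C K O : ℕ
    D = suc d
    C = 8 * D
    K = X / C
    O = oddCount X
    C≤X : C ≤ X
    C≤X = ≤-trans (m≤m*n C C) C*C≤X
    regroup : ∀ o d → suc o * d * 8 ≡ suc o * (8 * d)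
    regroup = solve-∀
    expand : ∀ k c → suc (2 * suc k) * c ≡ 3 * c + 2 * (k * c)
    expand = solve-∀
    collect : ∀ x → 3 * x + 2 * x + 3 * x ≡ x * 8
    collect = solve-∀

  ∣E⊖X∣≤1+O : ∀ E O X → E + O ≡ suc X → ℤ.∣ E ⊖ X ∣ ≤ suc O
  ∣E⊖X∣≤1+O E O X E+O≡1+X with ≤-total E X
  ... | inj₁ E≤X = begin
    ℤ.∣ E ⊖ X ∣      ≡⟨ ∣⊖∣-≤ E≤X ⟩
    X ∸ E            ≤⟨ ∸-monoˡ-≤ E (n≤1+n X) ⟩
    suc X ∸ E        ≡⟨ cong (_∸ E) E+O≡1+X ⟨
    E + O ∸ E        ≡⟨ m+n∸m≡n E O ⟩
    O                <⟨ n<1+n O ⟩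
    suc O            ∎
    where open ≤-Reasoning
  ... | inj₂ X≤E = begin
    ℤ.∣ E ⊖ X ∣      ≡⟨ ∣m⊖n∣≡∣n⊖m∣ E X ⟩
    ℤ.∣ X ⊖ E ∣      ≡⟨ ∣⊖∣-≤ X≤E ⟩
    E ∸ X            ≤⟨ ∸-monoˡ-≤ X (m≤m+n E O) ⟩
    E + O ∸ X        ≡⟨ cong (_∸ X) E+O≡1+X ⟩
    suc X ∸ X        ≡⟨ trans (cong (_∸ X) (+-comm 1 X)) (m+n∸m≡n X 1) ⟩
    1                ≤⟨ s≤s z≤n ⟩
    suc O            ∎
    where open ≤-Reasoning

open import Data.Nat using (ℕ; NonZero)
open import Data.Integer using (+_)
open import Data.Rational using (ℚ; _/_; ∣_∣; _-_; _<_; 0ℚ; 1ℚ)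
open import Data.Product using (∃)

import Data.Integer as ℤ
import Data.Integer.Properties as ℤ
import Data.Nat as ℕ
import Data.Nat.Properties as ℕ
import Data.Rational as ℚ
import Data.Rational.Properties as ℚ
import Data.Rational.Unnormalised as ℚᵘ
import Data.Rational.Unnormalised.Properties as ℚᵘ
open import Data.Integer using (+[1+_]; -[1+_]; _⊖_)
open import Data.Product using (_,_)
open import Data.Rational using (mkℚ; ↧ₙ_; toℚᵘ; *<*)
open import Data.Rational.Unnormalised using (mkℚᵘ)
open import Relation.Binary.PropositionalEquality
open Parity using (evenCount+oddCount; oddCount-small; ∣E⊖X∣≤1+O)

-- In ℚᵘ the inequality is the cross-multiplied ∣E - X∣ (d + 1) < (a + 1) X, for ε = (a + 1)/(d + 1).
∣E/X-1∣<ε : ∀ E X .{{_ : ℕ.NonZero X}} (ε : ℚ) → 0ℚ < ε → ℤ.∣ E ⊖ X ∣ ℕ.* ↧ₙ ε ℕ.< X → ∣ (+ E) / X - 1ℚ ∣ < ε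
∣E/X-1∣<ε E (ℕ.suc X′) (mkℚ +[1+ a ] d _) _ close = ℚ.toℚᵘ-cancel-< (ℚᵘ.<-respˡ-≃ (ℚᵘ.≃-sym toℚᵘ-lhs) (ℚᵘ.*<* scaled))
  where
  X : ℕ
  X = ℕ.suc X′
  toℚᵘ-lhs : toℚᵘ ∣ (+ E) / X - 1ℚ ∣ ℚᵘ.≃ ℚᵘ.∣ mkℚᵘ (+ E) X′ ℚᵘ.+ mkℚᵘ -[1+ 0 ] 0 ∣
  toℚᵘ-lhs = ℚᵘ.≃-trans (ℚ.toℚᵘ-homo-∣-∣ ((+ E) / X - 1ℚ))
    (ℚᵘ.∣-∣-cong (ℚᵘ.≃-trans (ℚ.toℚᵘ-homo-+ ((+ E) / X) (ℚ.- 1ℚ))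
      (ℚᵘ.+-congˡ (mkℚᵘ -[1+ 0 ] 0) (ℚ.toℚᵘ-fromℚᵘ (mkℚᵘ (+ E) X′)))))
  numerator≡ : (+ E) ℤ.* (+ 1) ℤ.+ (-[1+ 0 ] ℤ.* (+ X)) ≡ E ⊖ X
  numerator≡ = trans (cong₂ ℤ._+_ (ℤ.*-identityʳ (+ E)) (ℤ.-1*i≡-i (+ X))) (ℤ.m-n≡m⊖n E X)
  scaled : (+ ℤ.∣ (+ E) ℤ.* (+ 1) ℤ.+ (-[1+ 0 ] ℤ.* (+ X)) ∣) ℤ.* (+ ℕ.suc d) ℤ.< +[1+ a ] ℤ.* (+ ℕ.suc (X′ ℕ.* 1))
  scaled rewrite numerator≡ | sym (ℤ.pos-* (ℤ.∣ E ⊖ X ∣) (ℕ.suc d)) | sym (ℤ.pos-* (ℕ.suc a) (ℕ.suc (X′ ℕ.* 1))) | ℕ.*-identityʳ X′ =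
    ℤ.+<+ (ℕ.≤-trans close (ℕ.m≤n*m X (ℕ.suc a)))
∣E/X-1∣<ε E (ℕ.suc X′) (mkℚ (+ 0) _ _) (*<* (ℤ.+<+ ()))
∣E/X-1∣<ε E (ℕ.suc X′) (mkℚ -[1+ _ ] _ _) (*<* ())

theorem1p3 : (ε : ℚ) → 0ℚ < ε → ∃ λ (N : ℕ) → (X : ℕ) → .{{_ : NonZero X}} → N Data.Nat.≤ X →
    ∣ (+ evenCount X) / X - 1ℚ ∣ < ε
theorem1p3 ε 0<ε = N , λ X N≤X → ∣E/X-1∣<ε (evenCount X) X ε 0<ε (few-odd X N≤X)
  where
  d : ℕ
  d = ℚ.denominator-1 ε
  N : ℕ
  N = (8 ℕ.* ℕ.suc d) ℕ.* (8 ℕ.* ℕ.suc d)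
  few-odd : ∀ X → N ℕ.≤ X → ℤ.∣ evenCount X ⊖ X ∣ ℕ.* ℕ.suc d ℕ.< X
  few-odd X N≤X = ℕ.≤-<-trans (ℕ.*-monoˡ-≤ (ℕ.suc d) (∣E⊖X∣≤1+O _ _ X (evenCount+oddCount X))) (oddCount-small d X N≤X)
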